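{- Let $\Pi$ be a linear $m$-scheme on $S\subseteq V$. For $k\in[m]$, $B\in\Pi^{(k)}$, $\mathbf{x}=(x_1,\dots,x_k),\mathbf{y}=(y_1,\dots,y_k)\in B$ and $c_1,\dots,c_k\in\mathbb{F}$, we have $\sum_{i=1}^k c_ix_i=0$ if and only if $\sum_{i=1}^k c_iy_i=0$.
   Context: $V$ is a finite-dimensional vector space over a finite field $\mathbb{F}$. $\mathcal{M}_{k,k'}$ is the set of maps $V^k\to V^{k'}$, $(x_1,\dots,x_k)\mapsto(\sum_i c_{i,1}x_i,\dots,\sum_i c_{i,k'}x_i)$, $c_{i,j}\in\mathbb{F}$. A linear $m$-scheme on $S$ is $\Pi=\{\Pi^{(1)},\dots,\Pi^{(m)}\}$ with $\Pi^{(k)}$ a partition of $S^k$ such that for all $k,k'\in[m]$, $B\in\Pi^{(k)}$, $B'\in\Pi^{(k')}$, $\tau\in\mathcal{M}_{k,k'}$: (P1) $\tau(B)=B'$ or $\tau(B)\cap B'=\emptyset$; (P2) $\#\{x\in B:\tau(x)=y\}$ is constant for $y\in B'$. -}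

module Defs where

open import Level using (0ℓ)
open import Data.Nat using (ℕ; suc; zero)
open import Data.Fin using (Fin; toℕ)
open import Data.Vec using (Vec; []; _∷_; zipWith; replicate; map; lookup; tabulate; foldr)
open import Data.List using (List; length; filter)
open import Data.List.Membership.Propositional using (_∈_)
open import Data.List.Relation.Unary.All using (All)
open import Data.List.Relation.Unary.Unique.Propositional using (Unique)
open import Data.Product using (Σ; ∃; _×_)
open import Data.Sum using (_⊎_)
open import Relation.Binary.PropositionalEquality using (_≡_)
open import Relation.Binary.Definitions using (DecidableEquality)
open import Relation.Nullary using (¬_)
open import Algebra.Structures using (IsCommutativeRing)
open import Function.Bundles using (_⇔_)
import Data.Vec.Properties as VecP

record FiniteField : Set₁ where
  infixl 6 _+_
  infixl 7 _*_
  field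
    F          : Set
    _+_ _*_    : F → F → F
    -_         : F → F
    0# 1#      : F
    isCommutativeRing : IsCommutativeRing _≡_ _+_ _*_ -_ 0# 1#
    0≢1        : ¬ (0# ≡ 1#)
    inverse    : ∀ x → ¬ (x ≡ 0#) → ∃ λ y → x * y ≡ 1#
    _≟_        : DecidableEquality F
    elements   : List F
    complete   : ∀ x → x ∈ elements

module _ (𝔽 : FiniteField) where
  open FiniteField 𝔽

  -- The n-dimensional vector space F^n (every finite-dimensional
  -- vector space over F is isomorphic to one of these).
  Vect : ℕ → Set
  Vect n = Vec F n

  module _ {n : ℕ} where
    zeroV : Vect n
    zeroV = replicate n 0#

    _+V_ : Vect n → Vect n → Vect n
    _+V_ = zipWith _+_

    _·V_ : F → Vect n → Vect n
    c ·V v = map (c *_) v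

    lincomb : ∀ {k} → Vec F k → Vec (Vect n) k → Vect n
    lincomb []       []       = zeroV
    lincomb (c ∷ cs) (x ∷ xs) = (c ·V x) +V lincomb cs xs

    -- τ ∈ M_{k,k'}, given by coefficients c i j (i ∈ [k], j ∈ [k']):
    -- (x_1..x_k) ↦ (Σ_i c_{i,1} x_i, …, Σ_i c_{i,k'} x_i)
    Coeffs : ℕ → ℕ → Set
    Coeffs k k' = Fin k → Fin k' → F

    applyM : ∀ {k k'} → Coeffs k k' → Vec (Vect n) k → Vec (Vect n) k'
    applyM c xs = tabulate λ j → lincomb (tabulate λ i → c i j) xs

    _≟V_ : ∀ {k} → DecidableEquality (Vec (Vect n) k)
    _≟V_ = VecP.≡-dec (VecP.≡-dec _≟_)

record Partition (A : Set) (P : A → Set) : Set where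
  field
    nblocks  : ℕ
    block    : Fin nblocks → List A
    unique   : ∀ b → Unique (block b)
    nonempty : ∀ b → ∃ λ x → x ∈ block b
    inside   : ∀ b → All P (block b)
    cover    : ∀ x → P x → ∃ λ b → x ∈ block b
    disjoint : ∀ b b' x → x ∈ block b → x ∈ block b' → b ≡ b'

module _ (𝔽 : FiniteField) {n : ℕ} where
  open FiniteField 𝔽

  _^[_] : (Vect 𝔽 n → Set) → (k : ℕ) → Vec (Vect 𝔽 n) k → Set
  (S ^[ k ]) xs = ∀ i → S (lookup xs i)

  image : ∀ {k k'} → Coeffs 𝔽 {n} k k' → List (Vec (Vect 𝔽 n) k) → List (Vec (Vect 𝔽 n) k')
  image τ B = Data.List.map (applyM 𝔽 τ) B

  countFiber : ∀ {k k'} → Coeffs 𝔽 {n} k k' → List (Vec (Vect 𝔽 n) k) → Vec (Vect 𝔽 n) k' → ℕ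
  countFiber τ B y = length (filter (λ x → _≟V_ 𝔽 (applyM 𝔽 τ x) y) B)

  -- A linear m-scheme on S ⊆ V = F^n.  Π^{(k)} for k ∈ [m] is
  -- part (i) with k = suc (toℕ i), i : Fin m.
  record LinearScheme (m : ℕ) (S : Vect 𝔽 n → Set) : Set where
    field
      part : (i : Fin m) → Partition (Vec (Vect 𝔽 n) (suc (toℕ i))) (S ^[ suc (toℕ i) ])
    open Partition
    field
      P1 : ∀ (i i' : Fin m) (b : Fin (nblocks (part i))) (b' : Fin (nblocks (part i')))
             (τ : Coeffs 𝔽 {n} (suc (toℕ i)) (suc (toℕ i'))) →
             (∀ z → (z ∈ image τ (block (part i) b)) ⇔ (z ∈ block (part i') b'))
           ⊎ (∀ z → z ∈ image τ (block (part i) b) → ¬ (z ∈ block (part i') b'))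
      P2 : ∀ (i i' : Fin m) (b : Fin (nblocks (part i))) (b' : Fin (nblocks (part i')))
             (τ : Coeffs 𝔽 {n} (suc (toℕ i)) (suc (toℕ i'))) →
             ∀ y y' → y ∈ block (part i') b' → y' ∈ block (part i') b' →
             countFiber τ (block (part i) b) y ≡ countFiber τ (block (part i) b) y'

{-# OPTIONS --safe #-}
-- Suppose c₁x₁ + ⋯ + cₖxₖ = 0 for some x in the block B, and c ≠ 0, say cⱼ ≠ 0.
-- The linear map τ(z)ₗ = zₗ − δⱼₗ cⱼ⁻¹ (c₁z₁ + ⋯ + cₖzₖ) fixes every solution of
-- the equation and maps every tuple to a solution.  Hence τ(x) = x lies in
-- τ(B) ∩ B, so (P1) forces τ(B) = B, and every y ∈ B is a solution.
module Submission where

open import Level using (0ℓ)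
open import Data.Nat using (ℕ; suc)
open import Data.Fin using (Fin; toℕ; zero; suc)
import Data.Fin.Properties as Finₚ
open import Data.Vec using (Vec; []; _∷_; lookup; tabulate; map)
import Data.Vec.Properties as Vecₚ
open import Data.Vec.Functional using (Vector)
open import Data.List using (List)
open import Data.List.Membership.Propositional using (_∈_)
open import Data.List.Membership.Propositional.Properties using (∈-map⁺; ∈-map⁻)
open import Data.Product using (∃; _×_; _,_)
open import Data.Sum using (inj₁; inj₂)
open import Data.Empty using (⊥-elim)
open import Relation.Nullary using (yes; no)
import Relation.Binary.PropositionalEquality as ≡
open ≡ using (_≡_)
open import Function.Bundles using (_⇔_; mk⇔; Equivalence)
open import Algebra.Bundles using (CommutativeRing)

open import Defs

lookup-ext : ∀ {A : Set} {k} (u v : Vec A k) → (∀ i → lookup u i ≡ lookup v i) → u ≡ v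
lookup-ext u v u≗v = begin
  u                 ≡⟨ ≡.sym (Vecₚ.tabulate∘lookup u) ⟩
  tabulate (lookup u) ≡⟨ Vecₚ.tabulate-cong u≗v ⟩
  tabulate (lookup v) ≡⟨ Vecₚ.tabulate∘lookup v ⟩
  v                 ∎
  where open ≡.≡-Reasoning

module Transvection {c ℓ} (R : CommutativeRing c ℓ) where
  open CommutativeRing R hiding (zero)
  open import Algebra.Properties.Semiring.Sum semiring
    using (sum-syntax; ∑-distrib-+; *-distribˡ-sum; sum-cong-≋; sum-replicate-zero)
  open import Algebra.Properties.Ring ring using (-1*x≈-x)
  open import Algebra.Properties.CommutativeSemigroup *-commutativeSemigroup using (x∙yz≈y∙xz)
  open import Relation.Binary.Reasoning.Setoid setoid

  dot : ∀ {k} → Vector Carrier k → Vector Carrier k → Carrier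
  dot {k} u w = ∑[ i < k ] (u i * w i)

  δ : ∀ {k} → Fin k → Fin k → Carrier
  δ zero    zero    = 1#
  δ zero    (suc l) = 0#
  δ (suc i) zero    = 0#
  δ (suc i) (suc l) = δ i l

  δ-sym : ∀ {k} (i l : Fin k) → δ i l ≡ δ l i
  δ-sym zero    zero    = ≡.refl
  δ-sym zero    (suc l) = ≡.refl
  δ-sym (suc i) zero    = ≡.refl
  δ-sym (suc i) (suc l) = δ-sym i l

  ∑-zero : ∀ {k} (f : Vector Carrier k) → (∀ i → f i ≈ 0#) → ∑[ i < k ] f i ≈ 0#
  ∑-zero {k} f f≈0 = trans (sum-cong-≋ f≈0) (sum-replicate-zero k)

  dot-congˡ : ∀ {k} {u u′ : Vector Carrier k} (w : Vector Carrier k) →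
    (∀ i → u i ≈ u′ i) → dot u w ≈ dot u′ w
  dot-congˡ {k} w u≈u′ = sum-cong-≋ {k} (λ i → *-congʳ (u≈u′ i))

  dot-congʳ : ∀ {k} (u : Vector Carrier k) {w w′ : Vector Carrier k} →
    (∀ i → w i ≈ w′ i) → dot u w ≈ dot u w′
  dot-congʳ {k} u w≈w′ = sum-cong-≋ {k} (λ i → *-congˡ (w≈w′ i))

  dot-zeroˡ : ∀ {k} (u w : Vector Carrier k) → (∀ i → u i ≈ 0#) → dot u w ≈ 0#
  dot-zeroˡ u w u≈0 = ∑-zero _ (λ i → trans (*-congʳ (u≈0 i)) (zeroˡ (w i)))

  ∑-δ : ∀ {k} (j : Fin k) (f : Vector Carrier k) → ∑[ l < k ] (δ j l * f l) ≈ f j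
  ∑-δ {suc k} zero f = begin
    1# * f zero + ∑[ l < k ] (0# * f (suc l))
      ≈⟨ +-cong (*-identityˡ (f zero)) (∑-zero _ (λ l → zeroˡ (f (suc l)))) ⟩
    f zero + 0#  ≈⟨ +-identityʳ (f zero) ⟩
    f zero       ∎
  ∑-δ {suc k} (suc j) f = begin
    0# * f zero + ∑[ l < k ] (δ j l * f (suc l))
      ≈⟨ +-cong (zeroˡ (f zero)) (∑-δ j (λ l → f (suc l))) ⟩
    0# + f (suc j) ≈⟨ +-identityˡ (f (suc j)) ⟩
    f (suc j)      ∎

  -- Coefficients of z ↦ z + a ⟨u , z⟩ eⱼ, indexed as in `Coeffs`: entry i l is the
  -- coefficient of zᵢ in the l-th output.
  transvection : ∀ {k} → Vector Carrier k → Fin k → Carrier → Fin k → Fin k → Carrier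
  transvection u j a i l = δ i l + δ j l * (a * u i)

  module _ {k : ℕ} (u : Vector Carrier k) (j : Fin k) (a : Carrier) where

    private
      T = transvection u j a

    transvection-apply : ∀ (w : Vector Carrier k) l →
      dot (λ i → T i l) w ≈ w l + δ j l * (a * dot u w)
    transvection-apply w l = begin
      dot (λ i → T i l) w
        ≈⟨ sum-cong-≋ {k} (λ i → distribʳ (w i) (δ i l) _) ⟩
      ∑[ i < k ] (δ i l * w i + δ j l * (a * u i) * w i)
        ≈⟨ ∑-distrib-+ (λ i → δ i l * w i) (λ i → δ j l * (a * u i) * w i) ⟩
      ∑[ i < k ] (δ i l * w i) + ∑[ i < k ] (δ j l * (a * u i) * w i)
        ≈⟨ +-cong picks-wₗ scales-dot ⟩
      w l + δ j l * (a * dot u w) ∎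
      where
      picks-wₗ : ∑[ i < k ] (δ i l * w i) ≈ w l
      picks-wₗ = trans (sum-cong-≋ {k} (λ i → reflexive (≡.cong (_* w i) (δ-sym i l)))) (∑-δ l w)

      scales-dot : ∑[ i < k ] (δ j l * (a * u i) * w i) ≈ δ j l * (a * dot u w)
      scales-dot = begin
        ∑[ i < k ] (δ j l * (a * u i) * w i)
          ≈⟨ sum-cong-≋ {k} (λ i → trans (*-assoc _ _ _) (*-congˡ (*-assoc _ _ _))) ⟩
        ∑[ i < k ] (δ j l * (a * (u i * w i)))
          ≈⟨ sym (*-distribˡ-sum (δ j l) (λ i → a * (u i * w i))) ⟩
        δ j l * ∑[ i < k ] (a * (u i * w i))
          ≈⟨ *-congˡ (sym (*-distribˡ-sum a (λ i → u i * w i))) ⟩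
        δ j l * (a * dot u w) ∎

    transvection-fixes : ∀ (w : Vector Carrier k) → dot u w ≈ 0# →
      ∀ l → dot (λ i → T i l) w ≈ w l
    transvection-fixes w uw≈0 l = begin
      dot (λ i → T i l) w          ≈⟨ transvection-apply w l ⟩
      w l + δ j l * (a * dot u w)  ≈⟨ +-congˡ (*-congˡ (*-congˡ uw≈0)) ⟩
      w l + δ j l * (a * 0#)       ≈⟨ +-congˡ (trans (*-congˡ (zeroʳ a)) (zeroʳ (δ j l))) ⟩
      w l + 0#                     ≈⟨ +-identityʳ (w l) ⟩
      w l                          ∎

    transvection-solves : u j * a ≈ - 1# → ∀ (w : Vector Carrier k) →
      dot u (λ l → dot (λ i → T i l) w) ≈ 0#
    transvection-solves uⱼa≈-1 w = begin
      dot u (λ l → dot (λ i → T i l) w)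
        ≈⟨ dot-congʳ u (transvection-apply w) ⟩
      ∑[ l < k ] (u l * (w l + δ j l * (a * D)))
        ≈⟨ sum-cong-≋ {k} (λ l → distribˡ (u l) (w l) _) ⟩
      ∑[ l < k ] (u l * w l + u l * (δ j l * (a * D)))
        ≈⟨ ∑-distrib-+ (λ l → u l * w l) (λ l → u l * (δ j l * (a * D))) ⟩
      D + ∑[ l < k ] (u l * (δ j l * (a * D)))
        ≈⟨ +-congˡ (sum-cong-≋ {k} (λ l → x∙yz≈y∙xz (u l) (δ j l) (a * D))) ⟩
      D + ∑[ l < k ] (δ j l * (u l * (a * D)))
        ≈⟨ +-congˡ (∑-δ j (λ l → u l * (a * D))) ⟩
      D + u j * (a * D)  ≈⟨ +-congˡ (sym (*-assoc (u j) a D)) ⟩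
      D + u j * a * D    ≈⟨ +-congˡ (*-congʳ uⱼa≈-1) ⟩
      D + - 1# * D       ≈⟨ +-congˡ (-1*x≈-x D) ⟩
      D + - D            ≈⟨ -‿inverseʳ D ⟩
      0#                 ∎
      where D = dot u w

commutativeRing : FiniteField → CommutativeRing 0ℓ 0ℓ
commutativeRing 𝔽 = record { isCommutativeRing = FiniteField.isCommutativeRing 𝔽 }

module _ (𝔽 : FiniteField) {n : ℕ} where
  open FiniteField 𝔽 using (F; 0#; 1#; _*_; -_)
  open ≡ using (sym; trans; cong; cong₂)
  open ≡.≡-Reasoning
  open Transvection (commutativeRing 𝔽)
    using (dot; dot-congˡ; dot-congʳ; dot-zeroˡ; transvection; transvection-fixes; transvection-solves)

  coords : ∀ {k} → Vec (Vect 𝔽 n) k → Fin n → Vector F k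
  coords x p i = lookup (lookup x i) p

  lookup-lincomb : ∀ {k} (c : Vec F k) (x : Vec (Vect 𝔽 n) k) p →
    lookup (lincomb 𝔽 c x) p ≡ dot (lookup c) (coords x p)
  lookup-lincomb []       []       p = Vecₚ.lookup-replicate p 0#
  lookup-lincomb (c ∷ cs) (x ∷ xs) p = begin
    lookup (lincomb 𝔽 (c ∷ cs) (x ∷ xs)) p
      ≡⟨ Vecₚ.lookup-zipWith _ p (map (c *_) x) (lincomb 𝔽 cs xs) ⟩
    lookup (map (c *_) x) p + lookup (lincomb 𝔽 cs xs) p
      ≡⟨ cong₂ _+_ (Vecₚ.lookup-map p (c *_) x) (lookup-lincomb cs xs p) ⟩
    c * lookup x p + dot (lookup cs) (coords xs p) ∎
    where open FiniteField 𝔽 using (_+_)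

  coords-applyM : ∀ {k k′} (C : Coeffs 𝔽 {n} k k′) (x : Vec (Vect 𝔽 n) k) p l →
    coords (applyM 𝔽 C x) p l ≡ dot (λ i → C i l) (coords x p)
  coords-applyM C x p l = begin
    lookup (lookup (applyM 𝔽 C x) l) p
      ≡⟨ cong (λ v → lookup v p) (Vecₚ.lookup∘tabulate _ l) ⟩
    lookup (lincomb 𝔽 (tabulate (λ i → C i l)) x) p
      ≡⟨ lookup-lincomb (tabulate (λ i → C i l)) x p ⟩
    dot (lookup (tabulate (λ i → C i l))) (coords x p)
      ≡⟨ dot-congˡ (coords x p) (Vecₚ.lookup∘tabulate (λ i → C i l)) ⟩
    dot (λ i → C i l) (coords x p) ∎

  lincomb≡zeroV⇔ : ∀ {k} (c : Vec F k) (x : Vec (Vect 𝔽 n) k) →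
    (lincomb 𝔽 c x ≡ zeroV 𝔽) ⇔ (∀ p → dot (lookup c) (coords x p) ≡ 0#)
  lincomb≡zeroV⇔ c x = mk⇔
    (λ cx≡0 p → trans (sym (lookup-lincomb c x p))
                      (trans (cong (λ v → lookup v p) cx≡0) (Vecₚ.lookup-replicate p 0#)))
    (λ dots≡0 → lookup-ext _ _ λ p →
       trans (lookup-lincomb c x p) (trans (dots≡0 p) (sym (Vecₚ.lookup-replicate p 0#))))

  lincomb-zeroˡ : ∀ {k} (c : Vec F k) (x : Vec (Vect 𝔽 n) k) →
    (∀ i → lookup c i ≡ 0#) → lincomb 𝔽 c x ≡ zeroV 𝔽
  lincomb-zeroˡ c x c≡0 =
    Equivalence.from (lincomb≡zeroV⇔ c x) (λ p → dot-zeroˡ (lookup c) (coords x p) c≡0)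

  module _ {k : ℕ} (c : Vec F k) (j : Fin k) (a : F) where

    applyM-transvection-fixes : ∀ (x : Vec (Vect 𝔽 n) k) → lincomb 𝔽 c x ≡ zeroV 𝔽 →
      applyM 𝔽 (transvection (lookup c) j a) x ≡ x
    applyM-transvection-fixes x cx≡0 = lookup-ext _ _ λ l → lookup-ext _ _ λ p →
      trans (coords-applyM (transvection (lookup c) j a) x p l)
            (transvection-fixes (lookup c) j a (coords x p)
              (Equivalence.to (lincomb≡zeroV⇔ c x) cx≡0 p) l)

    lincomb-applyM-transvection : lookup c j * a ≡ - 1# → ∀ (z : Vec (Vect 𝔽 n) k) →
      lincomb 𝔽 c (applyM 𝔽 (transvection (lookup c) j a) z) ≡ zeroV 𝔽
    lincomb-applyM-transvection cⱼa≡-1 z = Equivalence.from (lincomb≡zeroV⇔ c _) λ p →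
      trans (dot-congʳ (lookup c) (coords-applyM (transvection (lookup c) j a) z p))
            (transvection-solves (lookup c) j a cⱼa≡-1 (coords z p))

module _ {𝔽 : FiniteField} {n m : ℕ} {S : Vect 𝔽 n → Set} (Π : LinearScheme 𝔽 {n} m S) where
  open FiniteField 𝔽 using (F; 0#; 1#; _*_; -_; _≟_; inverse)
  open import Algebra.Properties.Ring (CommutativeRing.ring (commutativeRing 𝔽)) using (-‿distribʳ-*)
  open Transvection (commutativeRing 𝔽) using (transvection)
  open LinearScheme Π using (part; P1)
  open Partition using (nblocks; block)
  open ≡ using (sym; trans; cong; subst)

  private
    Block : (i : Fin m) → Fin (nblocks (part i)) → List (Vec (Vect 𝔽 n) (suc (toℕ i)))
    Block i b = block (part i) b

  block-⊆-image : ∀ i i′ b b′ (τ : Coeffs 𝔽 {n} (suc (toℕ i)) (suc (toℕ i′))) {x y} →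
    x ∈ Block i b → applyM 𝔽 τ x ∈ Block i′ b′ → y ∈ Block i′ b′ →
    ∃ λ z → z ∈ Block i b × y ≡ applyM 𝔽 τ z
  block-⊆-image i i′ b b′ τ x∈B τx∈B′ y∈B′ with P1 i i′ b b′ τ
  ... | inj₁ τB≡B′   = ∈-map⁻ (applyM 𝔽 τ) (Equivalence.from (τB≡B′ _) y∈B′)
  ... | inj₂ τB∩B′≡∅ = ⊥-elim (τB∩B′≡∅ _ (∈-map⁺ (applyM 𝔽 τ) x∈B) τx∈B′)

  block-preserves-lincomb≡zeroV-pivot : ∀ i b {x y} → x ∈ Block i b → y ∈ Block i b →
    (c : Vec F (suc (toℕ i))) (j : Fin (suc (toℕ i))) (a : F) → lookup c j * a ≡ - 1# →
    lincomb 𝔽 c x ≡ zeroV 𝔽 → lincomb 𝔽 c y ≡ zeroV 𝔽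
  block-preserves-lincomb≡zeroV-pivot i b {x} x∈B y∈B c j a cⱼa≡-1 cx≡0
    with z , _ , y≡τz ← block-⊆-image i i b b (transvection (lookup c) j a) x∈B
      (subst (_∈ Block i b) (sym (applyM-transvection-fixes 𝔽 c j a x cx≡0)) x∈B) y∈B
    = subst (λ v → lincomb 𝔽 c v ≡ zeroV 𝔽) (sym y≡τz)
        (lincomb-applyM-transvection 𝔽 c j a cⱼa≡-1 z)

  block-preserves-lincomb≡zeroV : ∀ i b {x y} → x ∈ Block i b → y ∈ Block i b →
    (c : Vec F (suc (toℕ i))) → lincomb 𝔽 c x ≡ zeroV 𝔽 → lincomb 𝔽 c y ≡ zeroV 𝔽
  block-preserves-lincomb≡zeroV i b {y = y} x∈B y∈B c with Finₚ.all? (λ j → lookup c j ≟ 0#)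
  ... | yes c≡0 = λ _ → lincomb-zeroˡ 𝔽 c y c≡0
  ... | no c≢0
    with j , cⱼ≢0 ← Finₚ.¬∀⟶∃¬ _ _ (λ j → lookup c j ≟ 0#) c≢0
    with d , cⱼd≡1 ← inverse (lookup c j) cⱼ≢0
    = block-preserves-lincomb≡zeroV-pivot i b x∈B y∈B c j (- d)
        (trans (sym (-‿distribʳ-* (lookup c j) d)) (cong -_ cⱼd≡1))

lemma3p2 : (𝔽 : FiniteField) (n m : ℕ) (S : Vect 𝔽 n → Set)
    (Π : LinearScheme 𝔽 {n} m S) (i : Fin m)
    (b : Fin (Partition.nblocks (LinearScheme.part Π i)))
    (x y : Vec (Vect 𝔽 n) (suc (toℕ i))) →
    x ∈ Partition.block (LinearScheme.part Π i) b →
    y ∈ Partition.block (LinearScheme.part Π i) b →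
    (c : Vec (FiniteField.F 𝔽) (suc (toℕ i))) →
    (lincomb 𝔽 c x ≡ zeroV 𝔽) ⇔ (lincomb 𝔽 c y ≡ zeroV 𝔽)
lemma3p2 𝔽 n m S Π i b x y x∈B y∈B c = mk⇔
  (block-preserves-lincomb≡zeroV Π i b x∈B y∈B c)
  (block-preserves-lincomb≡zeroV Π i b y∈B x∈B c)
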